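{- Let $k<n\leqslant 2k$ be natural numbers. Then every graph $G$ on $n$ vertices satisfies $h_k(G)\geqslant f_0(n,k)$.
   Context: All graphs are finite, undirected, without loops or multiple edges. For a graph $G$ and a natural number $k$, $h_k(G)$ denotes the number of unordered pairs of distinct vertices of $G$ whose degrees differ by less than $k$. For natural numbers $n>k$, $$f_0(n,k):=\left(\left\lceil \tfrac{n}{k} \right\rceil - 2\right)\binom{k}{2} + \binom{k+1}{2} + \binom{n-k \left( \left\lceil\frac{n}{k} \right\rceil - 1 \right)-1}{2},$$ where $\binom{m}{2}=m(m-1)/2$. -}

module Defs where

open import Data.Nat using (ℕ; zero; suc; _+_; _*_; _∸_; _<_; _≤_; _/_)
open import Data.Bool using (Bool; true; false; T; not)
open import Data.Fin using (Fin; _<?_)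
open import Data.List using (List; length; filter; allFin; concatMap; map)
open import Data.Product using (_×_; _,_; proj₁; proj₂)
open import Relation.Binary.PropositionalEquality using (_≡_)
open import Relation.Nullary.Decidable using (⌊_⌋)
open import Data.Nat using (_<ᵇ_)

record Graph (n : ℕ) : Set where
  field
    adj   : Fin n → Fin n → Bool
    sym   : ∀ u v → adj u v ≡ adj v u
    irrefl : ∀ v → adj v v ≡ false

open Graph public

degree : ∀ {n} → Graph n → Fin n → ℕ
degree {n} G v = length (filter (λ u → T? (adj G v u)) (allFin n))
  where
    open import Data.Bool.Properties using (T?)

dist : ℕ → ℕ → ℕ
dist a b = (a ∸ b) + (b ∸ a)

pairs : ∀ n → List (Fin n × Fin n)
pairs n = concatMap (λ i → map (i ,_) (filter (λ j → i <? j) (allFin n))) (allFin n)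

h : ∀ {n} → ℕ → Graph n → ℕ
h {n} k G = length (filter (λ p → dist (degree G (proj₁ p)) (degree G (proj₂ p)) Data.Nat.<? k) (pairs n))
  where import Data.Nat

choose2 : ℕ → ℕ
choose2 m = (m * (m ∸ 1)) / 2

-- ceiling division ⌈n / k⌉ for k ≥ 1 (ceil n 0 is an arbitrary junk value 0)
ceil : ℕ → ℕ → ℕ
ceil n zero = zero
ceil n (suc k) = (n + k) / suc k

f0 : ℕ → ℕ → ℕ
f0 n k = (ceil n k ∸ 2) * choose2 k + choose2 (k + 1)
         + choose2 (n ∸ k * (ceil n k ∸ 1) ∸ 1)

-- Write n = k + m + 1 with m < k.  Degrees lie in [0, k + m], so two degrees differ by at least k
-- only if the smaller is at most m and the larger at least k.  Since f0 n k = C(n,2) − (k+1)m, it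
-- suffices to bound by (k+1)m the number F of ordered pairs (u, v) with d v ≥ d u + k.  Let L be the
-- vertices of degree ≤ m and H those of degree ≥ k, p = |L|, q = |H|, and S, D the degree sums over
-- L and H.  If p > k or q > k, the other class has at most m vertices and F ≤ pq ≤ (k+1)m.
-- Otherwise double counting gives kF + qS ≤ pD, S ≤ pm, qk ≤ D and D + q(p+1) ≤ qn + S (a vertex of
-- H misses at most n − 1 − d v vertices of L, and L sends at most S edges to H).  The last two,
-- weighted by k and k − p, give pD ≤ k(S + qm); with the first and k − q times the second this
-- yields kF ≤ k²m.
module Submission where

open import Defs hiding (sym)
open import Data.Nat using (ℕ; _<_; _≤_; _*_)
open import Data.Nat as ℕ using (zero; suc; _+_; _∸_; z≤n; NonZero; >-nonZero)
open import Data.Nat.Properties hiding (_<?_)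
open import Data.Nat.DivMod using (_/_; /-congˡ; +-distrib-/-∣ˡ; m*n/n≡m; m<n⇒m/n≡0)
open import Data.Nat.Divisibility using (divides-refl)
open import Data.Nat.Tactic.RingSolver using (solve-∀; solve)
open import Data.Bool using (if_then_else_)
open import Data.Bool.Properties using (T?)
open import Data.Fin using (Fin; zero; suc; _<?_; punchIn)
import Data.Fin.Properties as Fin
open import Data.List using (List; []; _∷_; _++_; length; filter; map; concatMap; tabulate; allFin)
open import Data.List.Properties using (length-++; filter-++)
open import Data.Vec.Functional using (removeAt)
open import Data.Product using (_×_; _,_)
open import Data.Sum using (_⊎_; inj₁; inj₂)
open import Function using (_∘_; id; flip)
open import Relation.Nullary using (Dec; yes; no; does; ¬_; contradiction)
open import Relation.Unary using (Decidable)
open import Relation.Binary.PropositionalEquality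
open import Algebra.Properties.Semiring.Sum +-*-semiring
  using (sum; sum-syntax; sum-cong-≗; ∑-distrib-+; ∑-comm; *-distribˡ-sum; *-distribʳ-sum; sum-remove)

𝟙 : {P : Set} → Dec P → ℕ
𝟙 P? = if does P? then 1 else 0

private
  variable
    A B : Set
    P Q R : Set

𝟙≤1 : (P? : Dec P) → 𝟙 P? ≤ 1
𝟙≤1 (yes _) = ≤-refl
𝟙≤1 (no _)  = z≤n

𝟙-yes : (P? : Dec P) → P → 𝟙 P? ≡ 1
𝟙-yes (yes _) _  = refl
𝟙-yes (no ¬p) p = contradiction p ¬p

𝟙-no : (P? : Dec P) → ¬ P → 𝟙 P? ≡ 0
𝟙-no (yes p) ¬p = contradiction p ¬p
𝟙-no (no _)  _  = refl

𝟙-*-≤ : (P? : Dec P) (x : ℕ) → 𝟙 P? * x ≤ x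
𝟙-*-≤ (yes _) x = ≤-reflexive (*-identityˡ x)
𝟙-*-≤ (no _)  x = z≤n

𝟙-*-mono : (P? : Dec P) {x y : ℕ} → (P → x ≤ y) → 𝟙 P? * x ≤ 𝟙 P? * y
𝟙-*-mono (yes p) x≤y = *-monoʳ-≤ 1 (x≤y p)
𝟙-*-mono (no _)  _   = z≤n

𝟙-disjoint : (P? : Dec P) (Q? : Dec Q) → (P → ¬ Q) → 𝟙 P? + 𝟙 Q? ≤ 1
𝟙-disjoint (yes p) (yes q) P⇒¬Q = contradiction q (P⇒¬Q p)
𝟙-disjoint (yes _) (no _)  _    = ≤-refl
𝟙-disjoint (no _)  Q?      _    = 𝟙≤1 Q?

𝟙-complement : (P? : Dec P) (Q? : Dec Q) → (P → ¬ Q) → (¬ P → Q) → 𝟙 P? + 𝟙 Q? ≡ 1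
𝟙-complement (yes p) Q? P⇒¬Q _  = cong suc (𝟙-no Q? (P⇒¬Q p))
𝟙-complement (no ¬p) Q? _   ¬P⇒Q = 𝟙-yes Q? (¬P⇒Q ¬p)

𝟙-≤-+ : (P? : Dec P) (Q? : Dec Q) (R? : Dec R) → (P → Q ⊎ R) → 𝟙 P? ≤ 𝟙 Q? + 𝟙 R?
𝟙-≤-+ (no _)  _  _  _ = z≤n
𝟙-≤-+ (yes p) Q? R? P⇒Q⊎R with P⇒Q⊎R p
... | inj₁ q = ≤-trans (≤-reflexive (sym (𝟙-yes Q? q))) (m≤m+n _ _)
... | inj₂ r = ≤-trans (≤-reflexive (sym (𝟙-yes R? r))) (m≤n+m _ _)

𝟙-≤-* : (P? : Dec P) (Q? : Dec Q) (R? : Dec R) → (P → Q) → (P → R) → 𝟙 P? ≤ 𝟙 Q? * 𝟙 R?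
𝟙-≤-* (no _)  _  _  _   _   = z≤n
𝟙-≤-* (yes p) Q? R? P⇒Q P⇒R rewrite 𝟙-yes Q? (P⇒Q p) | 𝟙-yes R? (P⇒R p) = ≤-refl

𝟙+𝟙≤𝟙*𝟙+1 : (P? : Dec P) (Q? : Dec Q) → 𝟙 P? + 𝟙 Q? ≤ 𝟙 Q? * 𝟙 P? + 1
𝟙+𝟙≤𝟙*𝟙+1 (yes _) (yes _) = ≤-refl
𝟙+𝟙≤𝟙*𝟙+1 (yes _) (no _)  = ≤-refl
𝟙+𝟙≤𝟙*𝟙+1 (no _)  (yes _) = ≤-refl
𝟙+𝟙≤𝟙*𝟙+1 (no _)  (no _)  = z≤n

∑-mono-≤ : ∀ {n} {f g : Fin n → ℕ} → (∀ i → f i ≤ g i) → ∑[ i < n ] f i ≤ ∑[ i < n ] g i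
∑-mono-≤ {zero}  f≤g = z≤n
∑-mono-≤ {suc n} f≤g = +-mono-≤ (f≤g zero) (∑-mono-≤ (f≤g ∘ suc))

∑-mono-< : ∀ {n} {f g : Fin n → ℕ} → (∀ i → f i ≤ g i) → (i : Fin n) → f i < g i →
           ∑[ j < n ] f j < ∑[ j < n ] g j
∑-mono-< {suc n} {f} {g} f≤g i fi<gi = begin-strict
  sum f                     ≡⟨ sum-remove {i = i} f ⟩
  f i + sum (removeAt f i)  <⟨ +-mono-<-≤ fi<gi (∑-mono-≤ (f≤g ∘ punchIn i)) ⟩
  g i + sum (removeAt g i)  ≡⟨ sum-remove {i = i} g ⟨
  sum g                     ∎
  where open ≤-Reasoning

∑-ones : ∀ n → ∑[ i < n ] 1 ≡ n
∑-ones zero    = refl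
∑-ones (suc n) = cong suc (∑-ones n)

module _ {m n : ℕ} where

  ∑∑-mono-≤ : {f g : Fin m → Fin n → ℕ} → (∀ i j → f i j ≤ g i j) →
              ∑[ i < m ] ∑[ j < n ] f i j ≤ ∑[ i < m ] ∑[ j < n ] g i j
  ∑∑-mono-≤ f≤g = ∑-mono-≤ (λ i → ∑-mono-≤ (f≤g i))

  ∑∑-distrib-+ : (f g : Fin m → Fin n → ℕ) →
                 ∑[ i < m ] ∑[ j < n ] (f i j + g i j) ≡
                 ∑[ i < m ] ∑[ j < n ] f i j + ∑[ i < m ] ∑[ j < n ] g i j
  ∑∑-distrib-+ f g = trans (sum-cong-≗ (λ i → ∑-distrib-+ (f i) (g i))) (∑-distrib-+ (sum ∘ f) (sum ∘ g))

  ∑∑-*ʳ : (f : Fin m → Fin n → ℕ) (c : ℕ) →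
          (∑[ i < m ] ∑[ j < n ] f i j) * c ≡ ∑[ i < m ] ∑[ j < n ] (f i j * c)
  ∑∑-*ʳ f c = trans (*-distribʳ-sum c (sum ∘ f)) (sum-cong-≗ (λ i → *-distribʳ-sum c (f i)))

  ∑*∑ : (f : Fin m → ℕ) (g : Fin n → ℕ) →
        (∑[ i < m ] f i) * (∑[ j < n ] g j) ≡ ∑[ i < m ] ∑[ j < n ] (f i * g j)
  ∑*∑ f g = trans (*-distribʳ-sum (sum g) f) (sum-cong-≗ (λ i → *-distribˡ-sum (f i) g))

choose2-suc : ∀ x → choose2 (suc x) ≡ x + choose2 x
choose2-suc x = begin
  suc x * x / 2                ≡⟨ /-congˡ (numerator x) ⟩
  (x * 2 + x * (x ∸ 1)) / 2    ≡⟨ +-distrib-/-∣ˡ (x * (x ∸ 1)) (divides-refl x) ⟩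
  x * 2 / 2 + choose2 x        ≡⟨ cong (_+ choose2 x) (m*n/n≡m x 2) ⟩
  x + choose2 x                ∎
  where
  open ≡-Reasoning
  numerator : ∀ y → suc y * y ≡ y * 2 + y * (y ∸ 1)
  numerator zero    = refl
  numerator (suc y) = expand y
    where
    expand : ∀ z → (2 + z) * (1 + z) ≡ (1 + z) * 2 + (1 + z) * z
    expand = solve-∀

choose2-+ : ∀ a b → choose2 (a + b) ≡ choose2 a + choose2 b + a * b
choose2-+ zero    b = sym (+-identityʳ (choose2 b))
choose2-+ (suc a) b = begin
  choose2 (suc (a + b))                     ≡⟨ choose2-suc (a + b) ⟩
  a + b + choose2 (a + b)                   ≡⟨ cong (a + b +_) (choose2-+ a b) ⟩
  a + b + (choose2 a + choose2 b + a * b)   ≡⟨ regroup a b (choose2 a) (choose2 b) (a * b) ⟩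
  a + choose2 a + choose2 b + (b + a * b)   ≡⟨ cong (λ c → c + choose2 b + suc a * b) (choose2-suc a) ⟨
  choose2 (suc a) + choose2 b + suc a * b   ∎
  where
  open ≡-Reasoning
  regroup : ∀ a b x y z → a + b + (x + y + z) ≡ a + x + y + (b + z)
  regroup = solve-∀

∑∑-<≡choose2 : ∀ n → ∑[ i < n ] ∑[ j < n ] 𝟙 (i <? j) ≡ choose2 n
∑∑-<≡choose2 zero    = refl
∑∑-<≡choose2 (suc n) = begin
  ∑[ j < n ] 1 + ∑[ i < n ] ∑[ j < n ] 𝟙 (i <? j)  ≡⟨ cong₂ _+_ (∑-ones n) (∑∑-<≡choose2 n) ⟩
  n + choose2 n                                    ≡⟨ choose2-suc n ⟨
  choose2 (suc n)                                  ∎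
  where open ≡-Reasoning

ceil≡2 : ∀ {k m} → m < k → ceil (suc (k + m)) k ≡ 2
ceil≡2 {suc k} {m} m<k = begin
  (suc (suc k + m) + k) / suc k   ≡⟨ /-congˡ {o = suc k} (regroup k m) ⟩
  (2 * suc k + m) / suc k         ≡⟨ +-distrib-/-∣ˡ m (divides-refl 2) ⟩
  2 * suc k / suc k + m / suc k   ≡⟨ cong₂ _+_ (m*n/n≡m 2 (suc k)) (m<n⇒m/n≡0 m<k) ⟩
  2                               ∎
  where
  open ≡-Reasoning
  regroup : ∀ k m → suc (suc k + m) + k ≡ 2 * suc k + m
  regroup = solve-∀

f0≡choose2[k+1]+choose2[m] : ∀ {k m} → m < k → f0 (suc (k + m)) k ≡ choose2 (k + 1) + choose2 m
f0≡choose2[k+1]+choose2[m] {k} {m} m<k = begin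
  f0 n k
    ≡⟨ cong (λ c → (c ∸ 2) * choose2 k + choose2 (k + 1) + choose2 (n ∸ k * (c ∸ 1) ∸ 1)) (ceil≡2 m<k) ⟩
  choose2 (k + 1) + choose2 (n ∸ k * 1 ∸ 1)
    ≡⟨ cong (λ c → choose2 (k + 1) + choose2 (c ∸ 1)) remainder ⟩
  choose2 (k + 1) + choose2 m
    ∎
  where
  open ≡-Reasoning
  n : ℕ
  n = suc (k + m)
  remainder : n ∸ k * 1 ≡ suc m
  remainder = begin
    suc (k + m) ∸ k * 1  ≡⟨ cong₂ _∸_ (sym (+-suc k m)) (*-identityʳ k) ⟩
    k + suc m ∸ k        ≡⟨ m+n∸m≡n k (suc m) ⟩
    suc m                ∎

length-filter-tabulate : ∀ {P : A → Set} (P? : Decidable P) {n} (f : Fin n → A) →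
  length (filter P? (tabulate f)) ≡ ∑[ i < n ] 𝟙 (P? (f i))
length-filter-tabulate P? {zero}  f = refl
length-filter-tabulate P? {suc n} f with P? (f zero)
... | yes _ = cong suc (length-filter-tabulate P? (f ∘ suc))
... | no _  = length-filter-tabulate P? (f ∘ suc)

length-filter-map : ∀ {P : B → Set} (P? : Decidable P) (g : A → B) (xs : List A) →
  length (filter P? (map g xs)) ≡ length (filter (P? ∘ g) xs)
length-filter-map P? g []       = refl
length-filter-map P? g (x ∷ xs) with P? (g x)
... | yes _ = cong suc (length-filter-map P? g xs)
... | no _  = length-filter-map P? g xs

length-filter-concatMap : ∀ {P : B → Set} (P? : Decidable P) {n} (g : A → List B) (f : Fin n → A) →
  length (filter P? (concatMap g (tabulate f))) ≡ ∑[ i < n ] length (filter P? (g (f i)))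
length-filter-concatMap P? {zero}  g f = refl
length-filter-concatMap P? {suc n} g f = begin
  length (filter P? (g (f zero) ++ concatMap g (tabulate (f ∘ suc))))
    ≡⟨ cong length (filter-++ P? (g (f zero)) _) ⟩
  length (filter P? (g (f zero)) ++ filter P? (concatMap g (tabulate (f ∘ suc))))
    ≡⟨ length-++ (filter P? (g (f zero))) ⟩
  length (filter P? (g (f zero))) + length (filter P? (concatMap g (tabulate (f ∘ suc))))
    ≡⟨ cong (length (filter P? (g (f zero))) +_) (length-filter-concatMap P? g (f ∘ suc)) ⟩
  ∑[ i < suc n ] length (filter P? (g (f i)))
    ∎
  where open ≡-Reasoning

length-filter-filter-tabulate : ∀ {P Q : A → Set} (P? : Decidable P) (Q? : Decidable Q) {n}
                                (f : Fin n → A) →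
  length (filter Q? (filter P? (tabulate f))) ≡ ∑[ i < n ] (𝟙 (P? (f i)) * 𝟙 (Q? (f i)))
length-filter-filter-tabulate P? Q? {zero}  f = refl
length-filter-filter-tabulate P? Q? {suc n} f with P? (f zero)
... | no _  = length-filter-filter-tabulate P? Q? (f ∘ suc)
... | yes _ with Q? (f zero)
...   | yes _ = cong suc (length-filter-filter-tabulate P? Q? (f ∘ suc))
...   | no _  = length-filter-filter-tabulate P? Q? (f ∘ suc)

length-filter-pairs : ∀ {n} {R : Fin n × Fin n → Set} (R? : Decidable R) →
  length (filter R? (pairs n)) ≡ ∑[ i < n ] ∑[ j < n ] (𝟙 (i <? j) * 𝟙 (R? (i , j)))
length-filter-pairs {n} R? = trans (length-filter-concatMap R? row id) (sum-cong-≗ λ i → begin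
  length (filter R? (row i))                                 ≡⟨ length-filter-map R? (i ,_) (later i) ⟩
  length (filter (R? ∘ (i ,_)) (later i))                    ≡⟨ length-filter-filter-tabulate (i <?_) (R? ∘ (i ,_)) id ⟩
  ∑[ j < n ] (𝟙 (i <? j) * 𝟙 (R? (i , j)))                   ∎)
  where
  open ≡-Reasoning
  later : Fin n → List (Fin n)
  later i = filter (i <?_) (allFin n)
  row : Fin n → List (Fin n × Fin n)
  row i = map (i ,_) (later i)

module _ {n : ℕ} (G : Graph n) where

  adjacency : Fin n → Fin n → ℕ
  adjacency u v = 𝟙 (T? (adj G u v))

  degree≡∑adjacency : ∀ v → degree G v ≡ ∑[ u < n ] adjacency v u
  degree≡∑adjacency v = length-filter-tabulate (T? ∘ adj G v) id

  degree<n : ∀ v → degree G v < n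
  degree<n v = begin-strict
    degree G v               ≡⟨ degree≡∑adjacency v ⟩
    ∑[ u < n ] adjacency v u <⟨ ∑-mono-< (λ u → 𝟙≤1 (T? (adj G v u))) v no-loop ⟩
    ∑[ u < n ] 1             ≡⟨ ∑-ones n ⟩
    n                        ∎
    where
    open ≤-Reasoning
    no-loop : adjacency v v < 1
    no-loop rewrite irrefl G v = ≤-refl

  ∑∑-weighted-adjacency : (w : Fin n → ℕ) →
    ∑[ v < n ] ∑[ u < n ] (w u * adjacency v u) ≡ ∑[ u < n ] (w u * degree G u)
  ∑∑-weighted-adjacency w = begin
    ∑[ v < n ] ∑[ u < n ] (w u * adjacency v u)
      ≡⟨ ∑-comm (λ v u → w u * adjacency v u) ⟩
    ∑[ u < n ] ∑[ v < n ] (w u * adjacency v u)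
      ≡⟨ sum-cong-≗ (λ u → *-distribˡ-sum (w u) (λ v → adjacency v u)) ⟨
    ∑[ u < n ] (w u * ∑[ v < n ] adjacency v u)
      ≡⟨ sum-cong-≗ (λ u → cong (w u *_) (column≡degree u)) ⟩
    ∑[ u < n ] (w u * degree G u)
      ∎
    where
    open ≡-Reasoning
    column≡degree : ∀ u → ∑[ v < n ] adjacency v u ≡ degree G u
    column≡degree u =
      trans (sum-cong-≗ (λ v → cong (𝟙 ∘ T?) (Graph.sym G v u))) (sym (degree≡∑adjacency u))

  degree+∣A∣<n+∣N∩A∣ : {A : Fin n → Set} (A? : Decidable A) {v : Fin n} → ¬ A v →
    degree G v + ∑[ u < n ] 𝟙 (A? u) < n + ∑[ u < n ] (𝟙 (A? u) * adjacency v u)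
  degree+∣A∣<n+∣N∩A∣ A? {v} v∉A = begin-strict
    degree G v + ∑[ u < n ] 𝟙 (A? u)
      ≡⟨ cong (_+ ∑[ u < n ] 𝟙 (A? u)) (degree≡∑adjacency v) ⟩
    ∑[ u < n ] adjacency v u + ∑[ u < n ] 𝟙 (A? u)
      ≡⟨ ∑-distrib-+ (adjacency v) (𝟙 ∘ A?) ⟨
    ∑[ u < n ] (adjacency v u + 𝟙 (A? u))
      <⟨ ∑-mono-< (λ u → 𝟙+𝟙≤𝟙*𝟙+1 (T? (adj G v u)) (A? u)) v v-itself ⟩
    ∑[ u < n ] (𝟙 (A? u) * adjacency v u + 1)
      ≡⟨ ∑-distrib-+ (λ u → 𝟙 (A? u) * adjacency v u) (λ _ → 1) ⟩
    ∑[ u < n ] (𝟙 (A? u) * adjacency v u) + ∑[ u < n ] 1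
      ≡⟨ trans (cong (∑[ u < n ] (𝟙 (A? u) * adjacency v u) +_) (∑-ones n)) (+-comm _ n) ⟩
    n + ∑[ u < n ] (𝟙 (A? u) * adjacency v u)
      ∎
    where
    open ≤-Reasoning
    v-itself : adjacency v v + 𝟙 (A? v) < 𝟙 (A? v) * adjacency v v + 1
    v-itself rewrite irrefl G v | 𝟙-no (A? v) v∉A = ≤-refl

  h+∑∑-distant≡choose2 : ∀ k →
    h k G + ∑[ i < n ] ∑[ j < n ] (𝟙 (i <? j) * 𝟙 (k ≤? dist (degree G i) (degree G j))) ≡ choose2 n
  h+∑∑-distant≡choose2 k = begin
    h k G + ∑[ i < n ] ∑[ j < n ] (lt i j * distant i j)
      ≡⟨ cong (_+ ∑[ i < n ] ∑[ j < n ] (lt i j * distant i j))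
              (length-filter-pairs (λ (i , j) → gap i j ℕ.<? k)) ⟩
    ∑[ i < n ] ∑[ j < n ] (lt i j * near i j) + ∑[ i < n ] ∑[ j < n ] (lt i j * distant i j)
      ≡⟨ ∑∑-distrib-+ (λ i j → lt i j * near i j) (λ i j → lt i j * distant i j) ⟨
    ∑[ i < n ] ∑[ j < n ] (lt i j * near i j + lt i j * distant i j)
      ≡⟨ sum-cong-≗ (λ i → sum-cong-≗ (λ j → near-or-distant i j)) ⟩
    ∑[ i < n ] ∑[ j < n ] lt i j
      ≡⟨ ∑∑-<≡choose2 n ⟩
    choose2 n
      ∎
    where
    open ≡-Reasoning
    gap : Fin n → Fin n → ℕ
    gap i j = dist (degree G i) (degree G j)
    lt near distant : Fin n → Fin n → ℕ
    lt i j = 𝟙 (i <? j)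
    near i j = 𝟙 (gap i j ℕ.<? k)
    distant i j = 𝟙 (k ≤? gap i j)
    near-or-distant : ∀ i j → lt i j * near i j + lt i j * distant i j ≡ lt i j
    near-or-distant i j = begin
      lt i j * near i j + lt i j * distant i j
        ≡⟨ *-distribˡ-+ (lt i j) (near i j) (distant i j) ⟨
      lt i j * (near i j + distant i j)
        ≡⟨ cong (lt i j *_) (𝟙-complement (gap i j ℕ.<? k) (k ≤? gap i j) <⇒≱ ≮⇒≥) ⟩
      lt i j * 1
        ≡⟨ *-identityʳ (lt i j) ⟩
      lt i j
        ∎

≤-dist⇒gap : ∀ {k x y} → k ≤ dist x y → x + k ≤ y ⊎ y + k ≤ x
≤-dist⇒gap {k} {x} {y} k≤dist with ≤-total x y
... | inj₁ x≤y = inj₁ (begin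
  x + k            ≤⟨ +-monoʳ-≤ x k≤dist ⟩
  x + dist x y     ≡⟨ cong (λ c → x + (c + (y ∸ x))) (m≤n⇒m∸n≡0 x≤y) ⟩
  x + (y ∸ x)      ≡⟨ m+[n∸m]≡n x≤y ⟩
  y                ∎)
  where open ≤-Reasoning
... | inj₂ y≤x = inj₂ (begin
  y + k            ≤⟨ +-monoʳ-≤ y k≤dist ⟩
  y + dist x y     ≡⟨ cong (λ c → y + ((x ∸ y) + c)) (m≤n⇒m∸n≡0 y≤x) ⟩
  y + (x ∸ y + 0)  ≡⟨ cong (y +_) (+-identityʳ (x ∸ y)) ⟩
  y + (x ∸ y)      ≡⟨ m+[n∸m]≡n y≤x ⟩
  x                ∎)
  where open ≤-Reasoning

product-bound : ∀ {c m x y} → x + y ≤ c + m → c ≤ x → m ≤ c → x * y ≤ c * m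
product-bound {c} {m} {x} {y} x+y≤c+m c≤x m≤c with m≤n⇒∃[o]m+o≡n y≤m
  where
  y≤m : y ≤ m
  y≤m = +-cancelˡ-≤ c y m (≤-trans (+-monoˡ-≤ y c≤x) x+y≤c+m)
... | t , refl = begin
  x * y          ≤⟨ *-monoˡ-≤ y x≤c+t ⟩
  (c + t) * y    ≡⟨ *-distribʳ-+ y c t ⟩
  c * y + t * y  ≤⟨ +-monoʳ-≤ (c * y) (*-monoʳ-≤ t (≤-trans (m≤m+n y t) m≤c)) ⟩
  c * y + t * c  ≡⟨ solve (c ∷ y ∷ t ∷ []) ⟩
  c * (y + t)    ∎
  where
  open ≤-Reasoning
  x≤c+t : x ≤ c + t
  x≤c+t = +-cancelʳ-≤ y x (c + t) (≤-trans x+y≤c+m (≤-reflexive (solve (c ∷ y ∷ t ∷ []))))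

high-degree-sum-bound : ∀ {k m p q S D} → p ≤ k → q * k ≤ D → D + q * suc p ≤ q * suc (k + m) + S →
                        p * D ≤ k * (S + q * m)
high-degree-sum-bound {k} {m} {p} {q} {S} {D} p≤k qk≤D D-bound with m≤n⇒∃[o]m+o≡n p≤k
... | p′ , refl = +-cancelʳ-≤ (p′ * (q * (p + p′))) (p * D) _ (begin
  p * D + p′ * (q * (p + p′))                  ≤⟨ +-monoʳ-≤ (p * D) (*-monoʳ-≤ p′ qk≤D) ⟩
  p * D + p′ * D                               ≡⟨ *-distribʳ-+ D p p′ ⟨
  (p + p′) * D                                 ≤⟨ *-monoʳ-≤ (p + p′) D≤S+q[p′+m] ⟩
  (p + p′) * (S + q * (p′ + m))                ≡⟨ solve (p ∷ p′ ∷ q ∷ m ∷ S ∷ []) ⟩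
  (p + p′) * (S + q * m) + p′ * (q * (p + p′)) ∎)
  where
  open ≤-Reasoning
  D≤S+q[p′+m] : D ≤ S + q * (p′ + m)
  D≤S+q[p′+m] = +-cancelʳ-≤ (q * suc p) D _
    (≤-trans D-bound (≤-reflexive (solve (p ∷ p′ ∷ q ∷ m ∷ S ∷ []))))

averaging-bound : ∀ {k m p q S D F} .{{_ : NonZero k}} → p ≤ k → q ≤ k →
                  F * k + S * q ≤ p * D → S ≤ p * m → q * k ≤ D → D + q * suc p ≤ q * suc (k + m) + S →
                  F ≤ k * m
averaging-bound {k} {m} {p} {q} {S} {D} {F} p≤k q≤k Fk+Sq≤pD S≤pm qk≤D D-bound with m≤n⇒∃[o]m+o≡n q≤k
... | q′ , refl = *-cancelʳ-≤ F (k * m) k (+-cancelʳ-≤ (S * q) (F * k) _ (begin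
  F * k + S * q                              ≤⟨ Fk+Sq≤pD ⟩
  p * D                                      ≤⟨ high-degree-sum-bound {m = m} {q = q} {S = S} p≤k qk≤D D-bound ⟩
  (q + q′) * (S + q * m)                     ≡⟨ solve (q ∷ q′ ∷ m ∷ S ∷ []) ⟩
  q′ * S + (q + q′) * (q * m) + S * q        ≤⟨ +-monoˡ-≤ (S * q) (+-monoˡ-≤ _ (*-monoʳ-≤ q′ S≤km)) ⟩
  q′ * (k * m) + (q + q′) * (q * m) + S * q  ≡⟨ solve (q ∷ q′ ∷ m ∷ S ∷ []) ⟩
  k * m * k + S * q                          ∎))
  where
  open ≤-Reasoning
  S≤km : S ≤ k * m
  S≤km = ≤-trans S≤pm (*-monoˡ-≤ m p≤k)

far-pairs-bound : ∀ {k m p q S D F} → m < k → F ≤ p * q → p + q ≤ suc k + m →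
                  F * k + S * q ≤ p * D → S ≤ p * m → q * k ≤ D → D + q * suc p ≤ q * suc (k + m) + S →
                  F ≤ suc k * m
far-pairs-bound {k} {m} {p} {q} m<k F≤pq p+q≤n Fk+Sq≤pD S≤pm qk≤D D-bound
  with p ≤? k | q ≤? k | m≤n⇒m≤1+n (<⇒≤ m<k)
... | yes p≤k | yes q≤k | _ = ≤-trans
  (averaging-bound {{>-nonZero (≤-<-trans z≤n m<k)}} p≤k q≤k Fk+Sq≤pD S≤pm qk≤D D-bound)
  (*-monoˡ-≤ m (n≤1+n k))
... | no p≰k | _ | m≤1+k = ≤-trans F≤pq (product-bound p+q≤n (≰⇒> p≰k) m≤1+k)
... | _ | no q≰k | m≤1+k = ≤-trans F≤pq (subst (_≤ suc k * m) (*-comm q p)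
  (product-bound (subst (_≤ suc k + m) (+-comm p q) p+q≤n) (≰⇒> q≰k) m≤1+k))

module DegreeClasses {k m : ℕ} (m<k : m < k) (G : Graph (suc (k + m))) where

  private
    n : ℕ
    n = suc (k + m)

  d : Fin n → ℕ
  d = degree G

  low? : Decidable (λ u → d u ≤ m)
  low? u = d u ≤? m

  high? : Decidable (λ v → k ≤ d v)
  high? v = k ≤? d v

  far? : (u v : Fin n) → Dec (d u + k ≤ d v)
  far? u v = d u + k ≤? d v

  low high : Fin n → ℕ
  low u = 𝟙 (low? u)
  high v = 𝟙 (high? v)

  far : Fin n → Fin n → ℕ
  far u v = 𝟙 (far? u v)

  p q S D F : ℕ
  p = ∑[ u < n ] low u
  q = ∑[ v < n ] high v
  S = ∑[ u < n ] (low u * d u)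
  D = ∑[ v < n ] (high v * d v)
  F = ∑[ u < n ] ∑[ v < n ] far u v

  distant-pairs : ℕ
  distant-pairs = ∑[ i < n ] ∑[ j < n ] (𝟙 (i <? j) * 𝟙 (k ≤? dist (d i) (d j)))

  d≤k+m : ∀ v → d v ≤ k + m
  d≤k+m v = ≤-pred (degree<n G v)

  gap⇒low : ∀ {x y} → y ≤ k + m → x + k ≤ y → x ≤ m
  gap⇒low {x} y≤k+m x+k≤y = +-cancelʳ-≤ k x m (≤-trans x+k≤y (≤-trans y≤k+m (≤-reflexive (+-comm k m))))

  gap⇒high : ∀ {x y} → x + k ≤ y → k ≤ y
  gap⇒high {x} x+k≤y = ≤-trans (m≤n+m k x) x+k≤y

  high⇒¬low : ∀ {x} → k ≤ x → ¬ x ≤ m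
  high⇒¬low k≤x x≤m = <⇒≱ m<k (≤-trans k≤x x≤m)

  F≤pq : F ≤ p * q
  F≤pq = begin
    F                                        ≤⟨ ∑∑-mono-≤ far≤low*high ⟩
    ∑[ u < n ] ∑[ v < n ] (low u * high v)   ≡⟨ ∑*∑ low high ⟨
    p * q                                    ∎
    where
    open ≤-Reasoning
    far≤low*high : ∀ u v → far u v ≤ low u * high v
    far≤low*high u v = 𝟙-≤-* (far? u v) (low? u) (high? v) (gap⇒low (d≤k+m v)) gap⇒high

  p+q≤n : p + q ≤ n
  p+q≤n = begin
    p + q                        ≡⟨ ∑-distrib-+ low high ⟨
    ∑[ u < n ] (low u + high u)  ≤⟨ ∑-mono-≤ (λ u → 𝟙-disjoint (low? u) (high? u) (flip high⇒¬low)) ⟩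
    ∑[ u < n ] 1                 ≡⟨ ∑-ones n ⟩
    n                            ∎
    where open ≤-Reasoning

  S≤pm : S ≤ p * m
  S≤pm = ≤-trans (∑-mono-≤ (λ u → 𝟙-*-mono (low? u) id)) (≤-reflexive (sym (*-distribʳ-sum m low)))

  qk≤D : q * k ≤ D
  qk≤D = ≤-trans (≤-reflexive (*-distribʳ-sum k high)) (∑-mono-≤ (λ v → 𝟙-*-mono (high? v) id))

  -- Stated for arbitrary decisions because `d u ≤? m` and its like normalise, so `with` cannot
  -- abstract over them.
  far-gap : ∀ {x y} → y ≤ k + m → (L : Dec (x ≤ m)) (H : Dec (k ≤ y)) (X : Dec (x + k ≤ y)) →
            𝟙 X * k + 𝟙 L * (𝟙 H * x) ≤ 𝟙 L * (𝟙 H * y)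
  far-gap y≤k+m (no ¬l)  _        (yes x+k≤y) = contradiction (gap⇒low y≤k+m x+k≤y) ¬l
  far-gap _     (yes _)  (no ¬h)  (yes x+k≤y) = contradiction (gap⇒high x+k≤y) ¬h
  far-gap {x} {y} _ (yes _) (yes _) (yes x+k≤y) = begin
    1 * k + 1 * (1 * x)  ≡⟨ cong₂ _+_ (*-identityˡ k) (trans (*-identityˡ (1 * x)) (*-identityˡ x)) ⟩
    k + x                ≤⟨ subst (_≤ y) (+-comm x k) x+k≤y ⟩
    y                    ≡⟨ trans (*-identityˡ (1 * y)) (*-identityˡ y) ⟨
    1 * (1 * y)          ∎
    where open ≤-Reasoning
  far-gap _ (yes x≤m) (yes k≤y) (no _) =
    *-monoʳ-≤ 1 (*-monoʳ-≤ 1 (<⇒≤ (≤-<-trans x≤m (<-≤-trans m<k k≤y))))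
  far-gap _ (yes _)   (no _)    (no _) = z≤n
  far-gap _ (no _)    _         (no _) = z≤n

  Fk+Sq≤pD : F * k + S * q ≤ p * D
  Fk+Sq≤pD = begin
    F * k + S * q
      ≡⟨ cong₂ _+_ (∑∑-*ʳ far k) (∑*∑ (λ u → low u * d u) high) ⟩
    ∑[ u < n ] ∑[ v < n ] (far u v * k) + ∑[ u < n ] ∑[ v < n ] (low u * d u * high v)
      ≡⟨ cong (∑[ u < n ] ∑[ v < n ] (far u v * k) +_)
              (sum-cong-≗ λ u → sum-cong-≗ λ v → regroup (low u) (d u) (high v)) ⟩
    ∑[ u < n ] ∑[ v < n ] (far u v * k) + ∑[ u < n ] ∑[ v < n ] (low u * (high v * d u))
      ≡⟨ ∑∑-distrib-+ (λ u v → far u v * k) (λ u v → low u * (high v * d u)) ⟨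
    ∑[ u < n ] ∑[ v < n ] (far u v * k + low u * (high v * d u))
      ≤⟨ ∑∑-mono-≤ (λ u v → far-gap (d≤k+m v) (low? u) (high? v) (far? u v)) ⟩
    ∑[ u < n ] ∑[ v < n ] (low u * (high v * d v))
      ≡⟨ ∑*∑ low (λ v → high v * d v) ⟨
    p * D
      ∎
    where
    open ≤-Reasoning
    regroup : ∀ a x b → a * x * b ≡ a * (b * x)
    regroup = solve-∀

  D+q[1+p]≤qn+S : D + q * suc p ≤ q * n + S
  D+q[1+p]≤qn+S = begin
    D + q * suc p
      ≡⟨ cong (D +_) (*-distribʳ-sum (suc p) high) ⟩
    ∑[ v < n ] (high v * d v) + ∑[ v < n ] (high v * suc p)
      ≡⟨ ∑-distrib-+ (λ v → high v * d v) (λ v → high v * suc p) ⟨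
    ∑[ v < n ] (high v * d v + high v * suc p)
      ≡⟨ sum-cong-≗ (λ v → *-distribˡ-+ (high v) (d v) (suc p)) ⟨
    ∑[ v < n ] (high v * (d v + suc p))
      ≤⟨ ∑-mono-≤ (λ v → 𝟙-*-mono (high? v) (missed-low v)) ⟩
    ∑[ v < n ] (high v * (n + low-neighbours v))
      ≡⟨ sum-cong-≗ (λ v → *-distribˡ-+ (high v) n (low-neighbours v)) ⟩
    ∑[ v < n ] (high v * n + high v * low-neighbours v)
      ≡⟨ ∑-distrib-+ (λ v → high v * n) (λ v → high v * low-neighbours v) ⟩
    ∑[ v < n ] (high v * n) + ∑[ v < n ] (high v * low-neighbours v)
      ≤⟨ +-mono-≤ (≤-reflexive (sym (*-distribʳ-sum n high)))
                  (∑-mono-≤ (λ v → 𝟙-*-≤ (high? v) (low-neighbours v))) ⟩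
    q * n + ∑[ v < n ] low-neighbours v
      ≡⟨ cong (q * n +_) (∑∑-weighted-adjacency G low) ⟩
    q * n + S
      ∎
    where
    open ≤-Reasoning
    low-neighbours : Fin n → ℕ
    low-neighbours v = ∑[ u < n ] (low u * adjacency G v u)
    missed-low : ∀ v → k ≤ d v → d v + suc p ≤ n + low-neighbours v
    missed-low v k≤dv = subst (_≤ n + low-neighbours v) (sym (+-suc (d v) p))
                              (degree+∣A∣<n+∣N∩A∣ G low? (high⇒¬low k≤dv))

  distant-pairs≤F : distant-pairs ≤ F
  distant-pairs≤F = begin
    ∑[ i < n ] ∑[ j < n ] (lt i j * 𝟙 (k ≤? dist (d i) (d j)))
      ≤⟨ ∑∑-mono-≤ (λ i j → *-monoʳ-≤ (lt i j) (distant≤far+far i j)) ⟩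
    ∑[ i < n ] ∑[ j < n ] (lt i j * (far i j + far j i))
      ≡⟨ sum-cong-≗ (λ i → sum-cong-≗ λ j → *-distribˡ-+ (lt i j) (far i j) (far j i)) ⟩
    ∑[ i < n ] ∑[ j < n ] (lt i j * far i j + lt i j * far j i)
      ≡⟨ ∑∑-distrib-+ (λ i j → lt i j * far i j) (λ i j → lt i j * far j i) ⟩
    ∑[ i < n ] ∑[ j < n ] (lt i j * far i j) + ∑[ i < n ] ∑[ j < n ] (lt i j * far j i)
      ≡⟨ cong (∑[ i < n ] ∑[ j < n ] (lt i j * far i j) +_) (∑-comm (λ i j → lt i j * far j i)) ⟩
    ∑[ i < n ] ∑[ j < n ] (lt i j * far i j) + ∑[ i < n ] ∑[ j < n ] (lt j i * far i j)
      ≡⟨ ∑∑-distrib-+ (λ i j → lt i j * far i j) (λ i j → lt j i * far i j) ⟨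
    ∑[ i < n ] ∑[ j < n ] (lt i j * far i j + lt j i * far i j)
      ≡⟨ sum-cong-≗ (λ i → sum-cong-≗ λ j → *-distribʳ-+ (far i j) (lt i j) (lt j i)) ⟨
    ∑[ i < n ] ∑[ j < n ] ((lt i j + lt j i) * far i j)
      ≤⟨ ∑∑-mono-≤ (λ i j → ≤-trans (*-monoˡ-≤ (far i j) (𝟙-disjoint (i <? j) (j <? i) Fin.<-asym))
                                    (≤-reflexive (*-identityˡ (far i j)))) ⟩
    F
      ∎
    where
    open ≤-Reasoning
    lt : Fin n → Fin n → ℕ
    lt i j = 𝟙 (i <? j)
    distant≤far+far : ∀ i j → 𝟙 (k ≤? dist (d i) (d j)) ≤ far i j + far j i
    distant≤far+far i j = 𝟙-≤-+ (k ≤? dist (d i) (d j)) (far? i j) (far? j i) ≤-dist⇒gap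

  F≤[1+k]m : F ≤ suc k * m
  F≤[1+k]m = far-pairs-bound m<k F≤pq p+q≤n Fk+Sq≤pD S≤pm qk≤D D+q[1+p]≤qn+S

f0≤h : ∀ {k m} → m < k → (G : Graph (suc (k + m))) → f0 (suc (k + m)) k ≤ h k G
f0≤h {k} {m} m<k G = +-cancelʳ-≤ ((k + 1) * m) (f0 (suc (k + m)) k) (h k G) (begin
  f0 (suc (k + m)) k + (k + 1) * m           ≡⟨ cong (_+ (k + 1) * m) (f0≡choose2[k+1]+choose2[m] m<k) ⟩
  choose2 (k + 1) + choose2 m + (k + 1) * m  ≡⟨ choose2-+ (k + 1) m ⟨
  choose2 (k + 1 + m)                        ≡⟨ cong choose2 (trans (+-assoc k 1 m) (+-suc k m)) ⟩
  choose2 (suc (k + m))                      ≡⟨ h+∑∑-distant≡choose2 G k ⟨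
  h k G + distant-pairs                      ≤⟨ +-monoʳ-≤ (h k G) (≤-trans distant-pairs≤F F≤[1+k]m) ⟩
  h k G + suc k * m                          ≡⟨ cong (λ c → h k G + c * m) (+-comm 1 k) ⟩
  h k G + (k + 1) * m                        ∎)
  where
  open DegreeClasses m<k G
  open ≤-Reasoning

theorem3 : (n k : ℕ) → k < n → n ≤ 2 * k → (G : Graph n) → f0 n k ≤ h k G
theorem3 n k k<n n≤2k G with m≤n⇒∃[o]m+o≡n k<n
... | m , refl = f0≤h m<k G
  where
  m<k : m < k
  m<k = +-cancelˡ-≤ k (suc m) k (begin
    k + suc m      ≡⟨ +-suc k m ⟩
    suc (k + m)    ≤⟨ n≤2k ⟩
    k + (k + 0)    ≡⟨ cong (k +_) (+-identityʳ k) ⟩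
    k + k          ∎)
    where open ≤-Reasoning
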